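{- Let $m\ge 4$ be an integer and let $g(x_1,x_2,x_3)=a_1(cx_1+\alpha_1)^2+a_2(cx_2+\alpha_2)^2+a_3(cx_3+\alpha_3)^2$ be tight regular, where $a_1,a_2,a_3$ are positive integers with $\gcd(a_1,a_2,a_3)=1$ and $a_1\le a_2\le a_3$, the $\mathbb{Z}$-lattice $\langle a_1,a_2,a_3\rangle$ is $p$-stable for every prime $p\nmid c$, the $\alpha_i$ are integers with $0<\alpha_i<\frac c2$, and $\gcd(c,\alpha_1\alpha_2\alpha_3)=1$. For $n\in\mathbb{Z}_{\ge 0}$ let $\beta(n)=\delta cn+a_1\alpha_1^2+a_2\alpha_2^2+a_3\alpha_3^2$. Then: (i) $\min\{g(x):x\in\mathbb{Z}^3\}=a_1\alpha_1^2+a_2\alpha_2^2+a_3\alpha_3^2$; (ii) for every prime divisor $p$ of $c$ and every $n\in\mathbb{Z}_{\ge0}$, $\beta(n)$ is represented by $g$ over $\mathbb{Z}_p$; (iii) for every prime $p$ not dividing $c$ and every $n\in\mathbb{Z}_{\ge0}$, $\beta(n)$ is represented by $g$ over $\mathbb{Z}_p$ if and only if $\beta(n)$ is represented by $\langle a_1,a_2,a_3\rangle$ over $\mathbb{Z}_p$.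
   Context: Define $\delta=4$ if $m$ is odd, $\delta=2$ if $m\equiv 2\pmod 4$, $\delta=1$ if $m\equiv 0\pmod 4$, and $c=\delta\frac{m-2}{2}$. An integer $n$ is represented by $g$ over $R$ if $g(x)=n$ for some $x\in R^3$; it is locally represented if represented over $\mathbb{Z}_p$ for all primes $p$ and over $\mathbb{R}$; $g$ is tight regular if it represents over $\mathbb{Z}$ every locally represented integer $n\ge\min\{g(x):x\in\mathbb{Z}^3\}$. $\langle a_1,a_2,a_3\rangle$ is the lattice with diagonal Gram matrix with entries $a_1,a_2,a_3$; $n$ is represented by it over $\mathbb{Z}_p$ if $a_1x_1^2+a_2x_2^2+a_3x_3^2=n$ is solvable in $\mathbb{Z}_p^3$. For an odd prime $p$ with non-square unit $\Delta_p$, a diagonal ternary lattice $K$ is $p$-stable if $\langle 1,-1\rangle$ is represented by $K_p=K\otimes\mathbb{Z}_p$ or $K_p\cong\langle 1,-\Delta_p\rangle\perp\langle p\epsilon\rangle$ with $\epsilon\in\mathbb{Z}_p^\times$; $K$ is $2$-stable if $K_2$ is unimodular or $\langle 1,3\rangle$ or $\langle 1,7\rangle$ is represented by $K_2$. -}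

module Defs where

open import Data.Nat as ℕ using (ℕ; zero; suc)
open import Data.Nat.DivMod using (_%_; _/_)
open import Data.Nat.GCD using (gcd)
open import Data.Nat.Primality using (Prime)
open import Data.Integer using (ℤ; +_; _+_; _*_; _-_; -_; _≤_; 0ℤ; 1ℤ)
open import Data.Integer.Divisibility using (_∣_)
open import Data.Fin using (Fin; zero; suc)
open import Data.Product using (Σ; ∃; ∃-syntax; _×_; _,_)
open import Relation.Binary.PropositionalEquality using (_≡_; _≢_)
open import Relation.Nullary using (¬_)
open import Function.Bundles using (_⇔_)

δ′ : ℕ → ℕ
δ′ 0 = 1
δ′ 1 = 4
δ′ 2 = 2
δ′ 3 = 4
δ′ _ = 1   -- unreachable (argument is m % 4)

δ : ℕ → ℕ
δ m = δ′ (m % 4)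

cOf : ℕ → ℕ
cOf m = (δ m ℕ.* (m ℕ.∸ 2)) / 2

Z3 : Set
Z3 = Fin 3 → ℤ

Qd : (a₁ a₂ a₃ : ℕ) → Z3 → ℤ
Qd a₁ a₂ a₃ x = + a₁ * (x zero * x zero) + + a₂ * (x (suc zero) * x (suc zero))
              + + a₃ * (x (suc (suc zero)) * x (suc (suc zero)))

Bd : (a₁ a₂ a₃ : ℕ) → Z3 → Z3 → ℤ
Bd a₁ a₂ a₃ x y = + a₁ * (x zero * y zero) + + a₂ * (x (suc zero) * y (suc zero))
                + + a₃ * (x (suc (suc zero)) * y (suc (suc zero)))

gf : (c a₁ a₂ a₃ α₁ α₂ α₃ : ℕ) → Z3 → ℤ
gf c a₁ a₂ a₃ α₁ α₂ α₃ x =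
  Qd a₁ a₂ a₃ (λ { zero → + c * x zero + + α₁
                 ; (suc zero) → + c * x (suc zero) + + α₂
                 ; (suc (suc zero)) → + c * x (suc (suc zero)) + + α₃ })

det3 : (Fin 3 → Fin 3 → ℤ) → ℤ
det3 M = M zero zero * (M one one * M two two - M one two * M two one)
       - M zero one * (M one zero * M two two - M one two * M two zero)
       + M zero two * (M one zero * M two one - M one one * M two zero)
  where
  one two : Fin 3
  one = suc zero
  two = suc (suc zero)

-- p-adic integers, presented as the inverse limit lim ℤ/p^k ℤ:
-- an element of ℤ_p is a sequence (x k)_k of integers with
-- x (k+1) ≡ x k (mod p^k); two such are equal iff they agree mod p^k for all k.

Seq : Set
Seq = ℕ → ℤ

Cong : ℕ → ℕ → ℤ → ℤ → Set
Cong p k a b = + (p ℕ.^ k) ∣ (a - b)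

IsZp : ℕ → Seq → Set
IsZp p x = ∀ k → Cong p k (x (suc k)) (x k)

EqZp : ℕ → Seq → Seq → Set
EqZp p x y = ∀ k → Cong p k (x k) (y k)

const : ℤ → Seq
const a _ = a

_⊗_ : Seq → Seq → Seq
(x ⊗ y) k = x k * y k

IsUnitZp : ℕ → Seq → Set
IsUnitZp p x = ¬ Cong p 1 (x 1) 0ℤ

IsSquareZp : ℕ → Seq → Set
IsSquareZp p x = ∃[ y ] (IsZp p y × EqZp p (y ⊗ y) x)

NonSquareUnit : ℕ → Seq → Set
NonSquareUnit p Δ = IsZp p Δ × IsUnitZp p Δ × ¬ IsSquareZp p Δ

SeqV : Set
SeqV = Fin 3 → Seq

IsZpV : ℕ → SeqV → Set
IsZpV p u = ∀ i → IsZp p (u i)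

at : SeqV → ℕ → Z3
at u k i = u i k

RepZ : (Z3 → ℤ) → ℤ → Set
RepZ f n = ∃[ x ] (f x ≡ n)

RepZp : ℕ → (Z3 → ℤ) → ℤ → Set
RepZp p f n = ∃[ u ] (IsZpV p u × EqZp p (λ k → f (at u k)) (const n))

-- n is represented over ℝ.  For the forms considered (a_i > 0, c > 0)
-- this is exactly n ≥ 0.
RepR : ℤ → Set
RepR n = 0ℤ ≤ n

LocRep : (Z3 → ℤ) → ℤ → Set
LocRep f n = (∀ p → Prime p → RepZp p f n) × RepR n

IsMin : (Z3 → ℤ) → ℤ → Set
IsMin f v = RepZ f v × (∀ x → v ≤ f x)

TightRegular : (Z3 → ℤ) → Set
TightRegular f = ∀ v → IsMin f v → ∀ n → v ≤ n → LocRep f n → RepZ f n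

RepBinZp : ℕ → (a₁ a₂ a₃ : ℕ) → ℤ → ℤ → Set
RepBinZp p a₁ a₂ a₃ s t =
  Σ SeqV λ u → Σ SeqV λ v → (IsZpV p u × IsZpV p v
    × EqZp p (λ k → Bd a₁ a₂ a₃ (at u k) (at u k)) (const s)
    × EqZp p (λ k → Bd a₁ a₂ a₃ (at v k) (at v k)) (const t)
    × EqZp p (λ k → Bd a₁ a₂ a₃ (at u k) (at v k)) (const 0ℤ))

-- K_p ≅ ⟨1,-Δ⟩ ⊥ ⟨p ε⟩ : there is a basis e₀,e₁,e₂ of ℤ_p^3 (coordinate
-- matrix with unit determinant) with Gram matrix diag(1, -Δ, p ε)
IsoStable : ℕ → (a₁ a₂ a₃ : ℕ) → Seq → Seq → Set
IsoStable p a₁ a₂ a₃ Δ ε =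
  Σ (Fin 3 → SeqV) λ e → ((∀ j → IsZpV p (e j))
    × IsUnitZp p (λ k → det3 (λ j i → e j i k))
    × EqZp p (λ k → Bd a₁ a₂ a₃ (at (e zero) k) (at (e zero) k)) (const 1ℤ)
    × EqZp p (λ k → Bd a₁ a₂ a₃ (at (e (suc zero)) k) (at (e (suc zero)) k)) (λ k → - Δ k)
    × EqZp p (λ k → Bd a₁ a₂ a₃ (at (e (suc (suc zero))) k) (at (e (suc (suc zero))) k))
             (λ k → + p * ε k)
    × EqZp p (λ k → Bd a₁ a₂ a₃ (at (e zero) k) (at (e (suc zero)) k)) (const 0ℤ)
    × EqZp p (λ k → Bd a₁ a₂ a₃ (at (e zero) k) (at (e (suc (suc zero))) k)) (const 0ℤ)
    × EqZp p (λ k → Bd a₁ a₂ a₃ (at (e (suc zero)) k) (at (e (suc (suc zero))) k)) (const 0ℤ))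

OddStable : ℕ → (a₁ a₂ a₃ : ℕ) → Set
OddStable p a₁ a₂ a₃ =
  RepBinZp p a₁ a₂ a₃ 1ℤ (- 1ℤ)
  ⊎′ (∃[ Δ ] ∃[ ε ] (NonSquareUnit p Δ × IsZp p ε × IsUnitZp p ε × IsoStable p a₁ a₂ a₃ Δ ε))
  where
  open import Data.Sum renaming (_⊎_ to _⊎′_)

Unimodular : ℕ → (a₁ a₂ a₃ : ℕ) → Set
Unimodular p a₁ a₂ a₃ = IsUnitZp p (const (+ (a₁ ℕ.* a₂ ℕ.* a₃)))

TwoStable : (a₁ a₂ a₃ : ℕ) → Set
TwoStable a₁ a₂ a₃ =
  Unimodular 2 a₁ a₂ a₃ ⊎′ (RepBinZp 2 a₁ a₂ a₃ 1ℤ (+ 3) ⊎′ RepBinZp 2 a₁ a₂ a₃ 1ℤ (+ 7))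
  where
  open import Data.Sum renaming (_⊎_ to _⊎′_)

Stable : ℕ → (a₁ a₂ a₃ : ℕ) → Set
Stable p a₁ a₂ a₃ = (p ≡ 2 → TwoStable a₁ a₂ a₃) × (p ≢ 2 → OddStable p a₁ a₂ a₃)

-- (i) As 0 < αᵢ < c/2, every c x + αᵢ with x ≠ 0 has absolute value at least c − αᵢ > αᵢ, so each
-- summand of g is minimal at x = 0.
-- (ii) For p ∣ c pick j with p ∤ aⱼ (gcd(a₁,a₂,a₃) = 1); then p ∤ αⱼ since gcd(c, α₁α₂α₃) = 1.  With
-- the other coordinates 0, β(n) is represented as soon as aⱼ((c y + αⱼ)² − αⱼ²) = δ c n has a p-adic
-- root.  Divided by c this reads aⱼ c y² + 2 aⱼ αⱼ y = δ n, whose linear coefficient is a unit for odd p.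
-- For p = 2, δ = 1 cannot occur (c is then odd), δ = 4 is handled by substituting y = 2y′, and δ = 2
-- forces 4 ∣ c, so one may divide by 2c instead.  Each time Hensel's lemma solves A y² + B y = N with
-- p ∣ A and B a p-adic unit.
-- (iii) For p ∤ c, c is a p-adic unit, so x ↦ c x + α is a bijection of ℤ_p³ carrying g to ⟨a₁,a₂,a₃⟩.
module Submission where

open import Defs
open import Data.Nat as ℕ using (ℕ; zero; suc; _≥_; _<_)
import Data.Nat.Properties as ℕ
import Data.Nat.Divisibility as ℕ
open import Data.Nat.Coprimality using (Coprime; coprime-Bézout)
open import Data.Nat.GCD using (gcd; gcd-greatest; module Bézout)
open import Data.Nat.Primality using (Prime; prime⇒irreducible; prime[2]; ¬prime[1])
open import Data.Nat.Divisibility using (_∣_; _∣?_; divides-refl; 1∣_; _∣0; ∣1⇒≡1; ∣m+n∣m⇒∣n; n∣m*n)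
open import Data.Nat.DivMod using (_%_; _/_; m≡m%n+[m/n]*n; [m+kn]%n≡m%n; m<n⇒m%n≡m; m%n<n; m*n/n≡m)
open import Data.Nat.Tactic.RingSolver using () renaming (solve-∀ to ℕ-solve-∀)
open import Data.Integer using (ℤ; +_; -[1+_]; +[1+_]; _+_; _*_; _-_; -_; 0ℤ; 1ℤ; ∣_∣; _≤_; +≤+)
open import Data.Integer.Properties
  using (pos-+; pos-*; +-inverseʳ; *-zeroʳ; +-identityˡ; *-comm; neg-distribˡ-*; abs-*; ∣i-j∣≤∣i∣+∣j∣; +◃n≡+n;
         *-monoˡ-≤-nonNeg; +-mono-≤; module ≤-Reasoning)
open import Data.Integer.Divisibility using () renaming (_∣_ to _∣ᵤ_)
open import Data.Integer.Divisibility.Signed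
  using (divides; ∣-refl; ∣ᵤ⇒∣; ∣⇒∣ᵤ; ∣m∣n⇒∣m+n; ∣n⇒∣m*n; ∣m⇒∣m*n; *-monoˡ-∣)
  renaming (_∣_ to _∣ℤ_)
open import Data.Integer.Tactic.RingSolver using (solve-∀)
open import Data.Fin using (Fin; zero; suc)
open import Data.Vec.Functional using ([]; _∷_)
open import Data.Product using (Σ; ∃-syntax; _×_; _,_; proj₁; proj₂)
open import Data.Sum using (_⊎_; inj₁; inj₂)
open import Data.Empty using (⊥-elim)
open import Function.Base using (_∘_)
open import Function.Bundles using (_⇔_; mk⇔)
open import Relation.Binary.PropositionalEquality
  using (_≡_; _≢_; refl; sym; trans; cong; cong₂; subst; module ≡-Reasoning)
open import Relation.Nullary using (¬_; yes; no)

-- Cong p k a b unfolds to a divisibility of a - b, from which unification cannot recover a and b;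
-- hence the endpoints are passed explicitly to these two conversions.
Cong⇒∣ : ∀ {p k a b} → Cong p k a b → + (p ℕ.^ k) ∣ℤ a - b
Cong⇒∣ = ∣ᵤ⇒∣

∣⇒Cong : ∀ {p k a b} → + (p ℕ.^ k) ∣ℤ a - b → Cong p k a b
∣⇒Cong = ∣⇒∣ᵤ

Cong-refl : ∀ p k a → Cong p k a a
Cong-refl p k a rewrite +-inverseʳ a = _ ∣0

IsZp-const : ∀ p a → IsZp p (const a)
IsZp-const p a k = Cong-refl p k a

IsZp-*ˡ : ∀ {p} e x → IsZp p x → IsZp p (λ k → e * x k)
IsZp-*ˡ {p} e x x-zp k =
  ∣⇒Cong {p} {k} {e * x (suc k)} {e * x k}
    (subst (+ (p ℕ.^ k) ∣ℤ_) (distrib e (x (suc k)) (x k)) (∣n⇒∣m*n e (Cong⇒∣ {p} {k} {x (suc k)} {x k} (x-zp k))))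
  where
  distrib : ∀ e x′ x → e * (x′ - x) ≡ e * x′ - e * x
  distrib = solve-∀

IsZp-+ʳ : ∀ {p} b x → IsZp p x → IsZp p (λ k → x k + b)
IsZp-+ʳ {p} b x x-zp k = subst (+ (p ℕ.^ k) ∣ᵤ_) (sym (cancel (x (suc k)) (x k) b)) (x-zp k)
  where
  cancel : ∀ x′ x b → (x′ + b) - (x + b) ≡ x′ - x
  cancel = solve-∀

record UnitMod (p : ℕ) (b : ℤ) : Set where
  constructor _,_
  field
    inverse : ℤ
    isInverse : + p ∣ℤ b * inverse - 1ℤ

UnitMod-* : ∀ {p a b} → UnitMod p a → UnitMod p b → UnitMod p (a * b)
UnitMod-* {p} {a} {b} (a⁻¹ , p∣aa⁻¹-1) (b⁻¹ , p∣bb⁻¹-1) =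
  a⁻¹ * b⁻¹ , subst (+ p ∣ℤ_) (product a a⁻¹ b b⁻¹) (∣m∣n⇒∣m+n (∣m⇒∣m*n (b * b⁻¹) p∣aa⁻¹-1) p∣bb⁻¹-1)
  where
  product : ∀ a a⁻¹ b b⁻¹ → (a * a⁻¹ - 1ℤ) * (b * b⁻¹) + (b * b⁻¹ - 1ℤ) ≡ a * b * (a⁻¹ * b⁻¹) - 1ℤ
  product = solve-∀

prime∤⇒coprime : ∀ {p b} → Prime p → ¬ (p ∣ b) → Coprime p b
prime∤⇒coprime {p} {b} p-prime p∤b {d} (d∣p , d∣b) with prime⇒irreducible p-prime d∣p
... | inj₁ d≡1 = d≡1
... | inj₂ refl = ⊥-elim (p∤b d∣b)

prime∣2⇒≡2 : ∀ {p} → Prime p → p ∣ 2 → p ≡ 2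
prime∣2⇒≡2 p-prime p∣2 with prime⇒irreducible prime[2] p∣2
... | inj₁ refl = ⊥-elim (¬prime[1] p-prime)
... | inj₂ p≡2 = p≡2

pos-Bézout : ∀ {d x m y n} → d ℕ.+ y ℕ.* n ≡ x ℕ.* m → + d + + y * + n ≡ + x * + m
pos-Bézout {d} {x} {m} {y} {n} eq = begin
  + d + + y * + n    ≡⟨ cong (_+_ (+ d)) (pos-* y n) ⟨
  + d + + (y ℕ.* n)  ≡⟨ pos-+ d (y ℕ.* n) ⟨
  + (d ℕ.+ y ℕ.* n)  ≡⟨ cong +_ eq ⟩
  + (x ℕ.* m)        ≡⟨ pos-* x m ⟩
  + x * + m          ∎
  where open ≡-Reasoning

prime∤⇒UnitMod : ∀ {p b} → Prime p → ¬ (p ∣ b) → UnitMod p (+ b)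
prime∤⇒UnitMod {p} {b} p-prime p∤b with coprime-Bézout (prime∤⇒coprime p-prime p∤b)
... | Bézout.+- x y eq = - + y , divides (- + x) (begin
  + b * - + y - 1ℤ    ≡⟨ negate (+ b) (+ y) ⟩
  - (1ℤ + + y * + b)  ≡⟨ cong -_ (pos-Bézout {1} {x} {p} {y} {b} eq) ⟩
  - (+ x * + p)       ≡⟨ neg-distribˡ-* (+ x) (+ p) ⟩
  - + x * + p         ∎)
  where
  open ≡-Reasoning
  negate : ∀ b y → b * - y - 1ℤ ≡ - (1ℤ + y * b)
  negate = solve-∀
... | Bézout.-+ x y eq = + y , divides (+ x) (begin
  + b * + y - 1ℤ          ≡⟨ cong (_- 1ℤ) (*-comm (+ b) (+ y)) ⟩
  + y * + b - 1ℤ          ≡⟨ cong (_- 1ℤ) (pos-Bézout {1} {y} {b} {x} {p} eq) ⟨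
  1ℤ + + x * + p - 1ℤ     ≡⟨ cancel (+ x * + p) ⟩
  + x * + p               ∎)
  where
  open ≡-Reasoning
  cancel : ∀ z → 1ℤ + z - 1ℤ ≡ z
  cancel = solve-∀

quadratic : ℤ → ℤ → ℤ → ℤ
quadratic A B y = A * (y * y) + B * y

-- Newton step: with t = -(q - r) B⁻¹ the term t P B cancels the error (q - r) P modulo p P, and
-- every other term of the expansion carries the factor A ≡ 0 (mod p).
hensel-lift : ∀ {p A B} → + p ∣ℤ A → UnitMod p B →
  ∀ {P y N N′} → P ∣ℤ quadratic A B y - N → P ∣ℤ N′ - N →
  ∃[ y′ ] (P ∣ℤ y′ - y × + p * P ∣ℤ quadratic A B y′ - N′)
hensel-lift {p} {A} {B} p∣A (b⁻¹ , p∣Bb⁻¹-1) {P} {y} {N} {N′} (divides q fy-N≡qP) (divides r N′-N≡rP) =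
  y + t * P , divides t (shift y (t * P)) ,
  subst (+ p * P ∣ℤ_) (sym expansion)
        (*-monoˡ-∣ P (∣m∣n⇒∣m+n (∣n⇒∣m*n (- (q - r)) p∣Bb⁻¹-1) (∣n⇒∣m*n t (∣m⇒∣m*n (+ 2 * y + t * P) p∣A))))
  where
  t T : ℤ
  t = - ((q - r) * b⁻¹)
  T = A * (+ 2 * y + t * P)

  shift : ∀ y h → y + h - y ≡ h
  shift = solve-∀

  taylor : ∀ A B y h N N′ → A * ((y + h) * (y + h)) + B * (y + h) - N′
         ≡ (A * (y * y) + B * y - N) - (N′ - N) + h * B + h * (A * (+ 2 * y + h))
  taylor = solve-∀

  collect : ∀ q r P b B T → q * P - r * P + - ((q - r) * b) * P * B + - ((q - r) * b) * P * T
          ≡ (- (q - r) * (B * b - 1ℤ) + - ((q - r) * b) * T) * P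
  collect = solve-∀

  expansion : quadratic A B (y + t * P) - N′ ≡ (- (q - r) * (B * b⁻¹ - 1ℤ) + t * T) * P
  expansion = begin
    quadratic A B (y + t * P) - N′
      ≡⟨ taylor A B y (t * P) N N′ ⟩
    (quadratic A B y - N) - (N′ - N) + t * P * B + t * P * T
      ≡⟨ cong₂ (λ u v → u - v + t * P * B + t * P * T) fy-N≡qP N′-N≡rP ⟩
    q * P - r * P + t * P * B + t * P * T
      ≡⟨ collect q r P b⁻¹ B T ⟩
    (- (q - r) * (B * b⁻¹ - 1ℤ) + t * T) * P
      ∎
    where open ≡-Reasoning

hensel : ∀ {p A B} → + p ∣ℤ A → UnitMod p B → (N : Seq) → IsZp p N →
  ∃[ y ] (IsZp p y × EqZp p (λ k → quadratic A B (y k)) N)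
hensel {p} {A} {B} p∣A B-unit N N-zp = root , root-zp , root-solves
  where
  Approx : ℕ → Set
  Approx k = Σ ℤ λ y → + (p ℕ.^ k) ∣ℤ quadratic A B y - N k

  refine : ∀ k (a : Approx k) → Σ (Approx (suc k)) λ a′ → + (p ℕ.^ k) ∣ℤ proj₁ a′ - proj₁ a
  refine k (y , y-approx) =
    let y′ , y′≈y , y′-approx = hensel-lift {p} {A} {B} p∣A B-unit {+ (p ℕ.^ k)} {y} {N k} {N (suc k)}
                                   y-approx (Cong⇒∣ {p} {k} {N (suc k)} {N k} (N-zp k))
    in (y′ , subst (λ P → P ∣ℤ quadratic A B y′ - N (suc k)) (sym (pos-* p (p ℕ.^ k))) y′-approx) , y′≈y

  approx : ∀ k → Approx k
  approx zero    = 0ℤ , Cong⇒∣ {p} {0} {quadratic A B 0ℤ} {N 0} (1∣ ∣ quadratic A B 0ℤ - N 0 ∣)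
  approx (suc k) = proj₁ (refine k (approx k))

  root : Seq
  root k = proj₁ (approx k)

  root-zp : IsZp p root
  root-zp k = ∣⇒Cong {p} {k} {root (suc k)} {root k} (proj₂ (refine k (approx k)))

  root-solves : EqZp p (λ k → quadratic A B (root k)) N
  root-solves k = ∣⇒Cong {p} {k} {quadratic A B (root k)} {N k} (proj₂ (approx k))

shiftedSquare : ℕ → ℕ → ℕ → ℤ → ℤ
shiftedSquare c a α x = + a * ((+ c * x + + α) * (+ c * x + + α))

record RepZp₁ (p : ℕ) (f : ℤ → ℤ) (t : ℤ) : Set where
  constructor repZp₁
  field
    point : Seq
    point-zp : IsZp p point
    represents : EqZp p (λ k → f (point k)) (const t)

RepZp₁-byHensel : ∀ {p f t} E D A B N → + p ∣ℤ A → UnitMod p B →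
  (∀ y → f (E * y) - t ≡ D * (quadratic A B y - N)) → RepZp₁ p f t
RepZp₁-byHensel {p} {f} {t} E D A B N p∣A B-unit reduce =
  let y , y-zp , y-root = hensel {p} {A} {B} p∣A B-unit (const N) (IsZp-const p N)
  in repZp₁ (λ k → E * y k) (IsZp-*ˡ E y y-zp) λ k →
       ∣⇒Cong {p} {k} {f (E * y k)} {t} (subst (+ (p ℕ.^ k) ∣ℤ_) (sym (reduce (y k)))
         (∣n⇒∣m*n D (Cong⇒∣ {p} {k} {quadratic A B (y k)} {N} (y-root k))))

pos-a[αα] : ∀ a α → + (a ℕ.* (α ℕ.* α)) ≡ + a * (+ α * + α)
pos-a[αα] a α = trans (pos-* a (α ℕ.* α)) (cong (+ a *_) (pos-* α α))

pos-dcn+a[αα] : ∀ d c n a α → + (d ℕ.* c ℕ.* n ℕ.+ a ℕ.* (α ℕ.* α)) ≡ + d * + c * + n + + a * (+ α * + α)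
pos-dcn+a[αα] d c n a α = trans (pos-+ (d ℕ.* c ℕ.* n) _)
  (cong₂ _+_ (trans (pos-* (d ℕ.* c) n) (cong (_* + n) (pos-* d c))) (pos-a[αα] a α))

module _ {c a α : ℕ} (n : ℕ) where

  shiftedSquare-rep-odd : ∀ {p} d → Prime p → p ≢ 2 → p ∣ c → ¬ (p ∣ a) → ¬ (p ∣ α) →
    RepZp₁ p (shiftedSquare c a α) (+ (d ℕ.* c ℕ.* n ℕ.+ a ℕ.* (α ℕ.* α)))
  shiftedSquare-rep-odd {p} d p-prime p≢2 p∣c p∤a p∤α =
    subst (RepZp₁ p _) (sym (pos-dcn+a[αα] d c n a α))
      (RepZp₁-byHensel 1ℤ (+ c) (+ a * + c) (+ 2 * + a * + α) (+ d * + n)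
        (∣n⇒∣m*n (+ a) (∣ᵤ⇒∣ p∣c))
        (UnitMod-* (UnitMod-* (prime∤⇒UnitMod p-prime (p≢2 ∘ prime∣2⇒≡2 p-prime))
                              (prime∤⇒UnitMod p-prime p∤a))
                   (prime∤⇒UnitMod p-prime p∤α))
        (identity (+ c) (+ a) (+ α) (+ d) (+ n)))
    where
    identity : ∀ c a α d n y → a * ((c * (1ℤ * y) + α) * (c * (1ℤ * y) + α)) - (d * c * n + a * (α * α))
             ≡ c * (a * c * (y * y) + + 2 * a * α * y - d * n)
    identity = solve-∀

  shiftedSquare-rep-δ4 : 2 ∣ c → ¬ (2 ∣ a) → ¬ (2 ∣ α) →
    RepZp₁ 2 (shiftedSquare c a α) (+ (4 ℕ.* c ℕ.* n ℕ.+ a ℕ.* (α ℕ.* α)))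
  shiftedSquare-rep-δ4 2∣c 2∤a 2∤α =
    subst (RepZp₁ 2 _) (sym (pos-dcn+a[αα] 4 c n a α))
      (RepZp₁-byHensel (+ 2) (+ 4 * + c) (+ a * + c) (+ a * + α) (+ n)
        (∣n⇒∣m*n (+ a) (∣ᵤ⇒∣ 2∣c))
        (UnitMod-* (prime∤⇒UnitMod prime[2] 2∤a) (prime∤⇒UnitMod prime[2] 2∤α))
        (identity (+ c) (+ a) (+ α) (+ n)))
    where
    identity : ∀ c a α n y → a * ((c * (+ 2 * y) + α) * (c * (+ 2 * y) + α)) - (+ 4 * c * n + a * (α * α))
             ≡ + 4 * c * (a * c * (y * y) + a * α * y - n)
    identity = solve-∀

  -- Writing c = 4 q and dividing by 2 c leaves the even quadratic coefficient a c / 2 = 2 a q.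
  shiftedSquare-rep-δ2 : 4 ∣ c → ¬ (2 ∣ a) → ¬ (2 ∣ α) →
    RepZp₁ 2 (shiftedSquare c a α) (+ (2 ℕ.* c ℕ.* n ℕ.+ a ℕ.* (α ℕ.* α)))
  shiftedSquare-rep-δ2 (divides-refl q) 2∤a 2∤α =
    subst (RepZp₁ 2 _) (sym (pos-dcn+a[αα] 2 (q ℕ.* 4) n a α))
      (RepZp₁-byHensel 1ℤ (+ 2 * + (q ℕ.* 4)) (+ a * + q * + 2) (+ a * + α) (+ n)
        (∣n⇒∣m*n (+ a * + q) ∣-refl)
        (UnitMod-* (prime∤⇒UnitMod prime[2] 2∤a) (prime∤⇒UnitMod prime[2] 2∤α))
        reduce)
    where
    reduce : ∀ y → + a * ((+ (q ℕ.* 4) * (1ℤ * y) + + α) * (+ (q ℕ.* 4) * (1ℤ * y) + + α))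
                   - (+ 2 * + (q ℕ.* 4) * + n + + a * (+ α * + α))
                 ≡ + 2 * + (q ℕ.* 4) * ((+ a * + q * + 2) * (y * y) + + a * + α * y - + n)
    reduce y = subst (λ C → + a * ((C * (1ℤ * y) + + α) * (C * (1ℤ * y) + + α))
                              - (+ 2 * C * + n + + a * (+ α * + α))
                            ≡ + 2 * C * ((+ a * + q * + 2) * (y * y) + + a * + α * y - + n))
                     (sym (pos-* q 4)) (identity (+ a) (+ q) (+ α) (+ n) y)
      where
      identity : ∀ a q α n y → a * ((q * + 4 * (1ℤ * y) + α) * (q * + 4 * (1ℤ * y) + α))
                   - (+ 2 * (q * + 4) * n + a * (α * α))
                 ≡ + 2 * (q * + 4) * (a * q * + 2 * (y * y) + a * α * y - n)
      identity = solve-∀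

  shiftedSquare-rep : ∀ {p} d → Prime p → p ∣ c → (p ≡ 2 → d ≡ 4 ⊎ (d ≡ 2 × 4 ∣ c)) →
    ¬ (p ∣ a) → ¬ (p ∣ α) → RepZp₁ p (shiftedSquare c a α) (+ (d ℕ.* c ℕ.* n ℕ.+ a ℕ.* (α ℕ.* α)))
  shiftedSquare-rep {p} d p-prime p∣c two-adic p∤a p∤α with p ℕ.≟ 2
  ... | no p≢2 = shiftedSquare-rep-odd d p-prime p≢2 p∣c p∤a p∤α
  ... | yes refl with two-adic refl
  ...   | inj₁ refl = shiftedSquare-rep-δ4 p∣c p∤a p∤α
  ...   | inj₂ (refl , 4∣c) = shiftedSquare-rep-δ2 4∣c p∤a p∤α

shiftedSquare-0 : ∀ c a α → shiftedSquare c a α 0ℤ ≡ + (a ℕ.* (α ℕ.* α))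
shiftedSquare-0 c a α = begin
  + a * ((+ c * 0ℤ + + α) * (+ c * 0ℤ + + α))  ≡⟨ cong (λ z → + a * ((z + + α) * (z + + α))) (*-zeroʳ (+ c)) ⟩
  + a * ((0ℤ + + α) * (0ℤ + + α))              ≡⟨ cong (λ z → + a * (z * z)) (+-identityˡ (+ α)) ⟩
  + a * (+ α * + α)                            ≡⟨ pos-a[αα] a α ⟨
  + (a ℕ.* (α ℕ.* α))                          ∎
  where open ≡-Reasoning

RepZp₁-shiftedSquare-0 : ∀ p c a α → RepZp₁ p (shiftedSquare c a α) (+ (a ℕ.* (α ℕ.* α)))
RepZp₁-shiftedSquare-0 p c a α =
  repZp₁ (const 0ℤ) (IsZp-const p 0ℤ) λ k →
    subst (λ v → Cong p k v (+ (a ℕ.* (α ℕ.* α)))) (sym (shiftedSquare-0 c a α)) (Cong-refl p k (+ (a ℕ.* (α ℕ.* α))))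

RepZp-sum : ∀ {p f₁ f₂ f₃ t₁ t₂ t₃} → RepZp₁ p f₁ t₁ → RepZp₁ p f₂ t₂ → RepZp₁ p f₃ t₃ →
  RepZp p (λ x → f₁ (x zero) + f₂ (x (suc zero)) + f₃ (x (suc (suc zero)))) (t₁ + t₂ + t₃)
RepZp-sum {p} {f₁} {f₂} {f₃} {t₁} {t₂} {t₃} (repZp₁ y₁ y₁-zp y₁-rep) (repZp₁ y₂ y₂-zp y₂-rep) (repZp₁ y₃ y₃-zp y₃-rep) =
  u , u-zp , λ k → ∣⇒Cong {p} {k} {f₁ (y₁ k) + f₂ (y₂ k) + f₃ (y₃ k)} {t₁ + t₂ + t₃}
    (subst (+ (p ℕ.^ k) ∣ℤ_) (regroup (f₁ (y₁ k)) (f₂ (y₂ k)) (f₃ (y₃ k)) t₁ t₂ t₃)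
    (∣m∣n⇒∣m+n (∣m∣n⇒∣m+n (Cong⇒∣ {p} {k} {f₁ (y₁ k)} {t₁} (y₁-rep k))
                          (Cong⇒∣ {p} {k} {f₂ (y₂ k)} {t₂} (y₂-rep k)))
               (Cong⇒∣ {p} {k} {f₃ (y₃ k)} {t₃} (y₃-rep k))))
  where
  u : SeqV
  u = y₁ ∷ y₂ ∷ y₃ ∷ []

  u-zp : IsZpV p u
  u-zp zero = y₁-zp
  u-zp (suc zero) = y₂-zp
  u-zp (suc (suc zero)) = y₃-zp

  regroup : ∀ x₁ x₂ x₃ t₁ t₂ t₃ → (x₁ - t₁) + (x₂ - t₂) + (x₃ - t₃) ≡ (x₁ + x₂ + x₃) - (t₁ + t₂ + t₃)
  regroup = solve-∀

α≤∣cx+α∣-nonzero : ∀ {c α} → 2 ℕ.* α < c → ∀ x → 1 ℕ.≤ ∣ x ∣ → α ℕ.≤ ∣ + c * x + + α ∣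
α≤∣cx+α∣-nonzero {c} {α} 2α<c x 1≤∣x∣ = ℕ.+-cancelʳ-≤ α α ∣ + c * x + + α ∣ (begin
  α ℕ.+ α                          ≡⟨ cong (α ℕ.+_) (ℕ.+-identityʳ α) ⟨
  2 ℕ.* α                          ≤⟨ ℕ.<⇒≤ 2α<c ⟩
  c                                ≡⟨ ℕ.*-identityʳ c ⟨
  c ℕ.* 1                          ≤⟨ ℕ.*-monoʳ-≤ c 1≤∣x∣ ⟩
  c ℕ.* ∣ x ∣                      ≡⟨ abs-* (+ c) x ⟨
  ∣ + c * x ∣                      ≡⟨ cong ∣_∣ (cancel (+ c * x) (+ α)) ⟨
  ∣ (+ c * x + + α) - + α ∣        ≤⟨ ∣i-j∣≤∣i∣+∣j∣ (+ c * x + + α) (+ α) ⟩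
  ∣ + c * x + + α ∣ ℕ.+ α          ∎)
  where
  open ℕ.≤-Reasoning
  cancel : ∀ y α → (y + α) - α ≡ y
  cancel = solve-∀

α≤∣cx+α∣ : ∀ {c α} → 2 ℕ.* α < c → ∀ x → α ℕ.≤ ∣ + c * x + + α ∣
α≤∣cx+α∣ {c} 2α<c (+ zero) rewrite *-zeroʳ (+ c) = ℕ.≤-refl
α≤∣cx+α∣ 2α<c x@(+[1+ _ ]) = α≤∣cx+α∣-nonzero 2α<c x (ℕ.s≤s ℕ.z≤n)
α≤∣cx+α∣ 2α<c x@(-[1+ _ ]) = α≤∣cx+α∣-nonzero 2α<c x (ℕ.s≤s ℕ.z≤n)

i*i≡+[∣i∣*∣i∣] : ∀ i → i * i ≡ + (∣ i ∣ ℕ.* ∣ i ∣)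
i*i≡+[∣i∣*∣i∣] (+ n) = +◃n≡+n (n ℕ.* n)
i*i≡+[∣i∣*∣i∣] -[1+ n ] = +◃n≡+n (suc n ℕ.* suc n)

shiftedSquare-min : ∀ {c α} a → 2 ℕ.* α < c → ∀ x → + (a ℕ.* (α ℕ.* α)) ≤ shiftedSquare c a α x
shiftedSquare-min {c} {α} a 2α<c x = begin
  + (a ℕ.* (α ℕ.* α))                          ≡⟨ pos-a[αα] a α ⟩
  + a * (+ α * + α)                            ≡⟨ cong (+ a *_) (pos-* α α) ⟨
  + a * + (α ℕ.* α)                            ≤⟨ *-monoˡ-≤-nonNeg (+ a) (+≤+ (ℕ.*-mono-≤ α≤∣y∣ α≤∣y∣)) ⟩
  + a * + (∣ y ∣ ℕ.* ∣ y ∣)                    ≡⟨ cong (+ a *_) (i*i≡+[∣i∣*∣i∣] y) ⟨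
  + a * (y * y)                                ∎
  where
  open ≤-Reasoning
  y : ℤ
  y = + c * x + + α
  α≤∣y∣ : α ℕ.≤ ∣ y ∣
  α≤∣y∣ = α≤∣cx+α∣ 2α<c x

pos-+₃ : ∀ x y z → + (x ℕ.+ y ℕ.+ z) ≡ + x + + y + + z
pos-+₃ x y z = trans (pos-+ (x ℕ.+ y) z) (cong (_+ + z) (pos-+ x y))

gf-min : ∀ c a₁ a₂ a₃ α₁ α₂ α₃ → 2 ℕ.* α₁ < c → 2 ℕ.* α₂ < c → 2 ℕ.* α₃ < c →
  IsMin (gf c a₁ a₂ a₃ α₁ α₂ α₃) (+ (a₁ ℕ.* (α₁ ℕ.* α₁) ℕ.+ a₂ ℕ.* (α₂ ℕ.* α₂) ℕ.+ a₃ ℕ.* (α₃ ℕ.* α₃)))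
gf-min c a₁ a₂ a₃ α₁ α₂ α₃ 2α₁<c 2α₂<c 2α₃<c = ((λ _ → 0ℤ) , value-at-0) , bound
  where
  s₁ s₂ s₃ : ℕ
  s₁ = a₁ ℕ.* (α₁ ℕ.* α₁)
  s₂ = a₂ ℕ.* (α₂ ℕ.* α₂)
  s₃ = a₃ ℕ.* (α₃ ℕ.* α₃)

  value-at-0 : gf c a₁ a₂ a₃ α₁ α₂ α₃ (λ _ → 0ℤ) ≡ + (s₁ ℕ.+ s₂ ℕ.+ s₃)
  value-at-0 = trans (cong₂ _+_ (cong₂ _+_ (shiftedSquare-0 c a₁ α₁) (shiftedSquare-0 c a₂ α₂)) (shiftedSquare-0 c a₃ α₃))
                     (sym (pos-+₃ s₁ s₂ s₃))

  bound : ∀ x → + (s₁ ℕ.+ s₂ ℕ.+ s₃) ≤ gf c a₁ a₂ a₃ α₁ α₂ α₃ x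
  bound x = subst (_≤ gf c a₁ a₂ a₃ α₁ α₂ α₃ x) (sym (pos-+₃ s₁ s₂ s₃))
    (+-mono-≤ (+-mono-≤ (shiftedSquare-min a₁ 2α₁<c (x zero)) (shiftedSquare-min a₂ 2α₂<c (x (suc zero))))
              (shiftedSquare-min a₃ 2α₃<c (x (suc (suc zero)))))

δ-residue : ∀ r q → r < 4 → δ (r ℕ.+ q ℕ.* 4) ≡ δ′ r
δ-residue r q r<4 = cong δ′ (trans ([m+kn]%n≡m%n r q 4) (m<n⇒m%n≡m r<4))

cOf-residue : ∀ r q → r < 4 → cOf (r ℕ.+ q ℕ.* 4) ≡ (δ′ r ℕ.* (r ℕ.+ q ℕ.* 4 ℕ.∸ 2)) / 2
cOf-residue r q r<4 = cong (λ d → (d ℕ.* (r ℕ.+ q ℕ.* 4 ℕ.∸ 2)) / 2) (δ-residue r q r<4)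

cOf-even⇒δ : ∀ m → 4 ℕ.≤ m → 2 ∣ cOf m → δ m ≡ 4 ⊎ (δ m ≡ 2 × 4 ∣ cOf m)
cOf-even⇒δ m = subst Claim (sym (m≡m%n+[m/n]*n m 4)) (by-residue (m % 4) (m / 4) (m%n<n m 4))
  where
  Claim : ℕ → Set
  Claim m = 4 ℕ.≤ m → 2 ∣ cOf m → δ m ≡ 4 ⊎ (δ m ≡ 2 × 4 ∣ cOf m)

  by-residue : ∀ r q → r < 4 → Claim (r ℕ.+ q ℕ.* 4)
  by-residue 0 zero    _   ()
  by-residue 0 (suc q) r<4 _ 2∣c = ⊥-elim (2≢1 (∣1⇒≡1 (∣m+n∣m⇒∣n 2∣2q+1 (n∣m*n q))))
    where
    2≢1 : 2 ≢ 1
    2≢1 ()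
    c≡2q+1 : cOf (suc q ℕ.* 4) ≡ q ℕ.* 2 ℕ.+ 1
    c≡2q+1 = trans (cOf-residue 0 (suc q) r<4)
                   (trans (cong (_/ 2) (double q)) (m*n/n≡m (q ℕ.* 2 ℕ.+ 1) 2))
      where
      double : ∀ q → 1 ℕ.* (2 ℕ.+ q ℕ.* 4) ≡ (q ℕ.* 2 ℕ.+ 1) ℕ.* 2
      double = ℕ-solve-∀
    2∣2q+1 : 2 ∣ q ℕ.* 2 ℕ.+ 1
    2∣2q+1 = subst (2 ∣_) c≡2q+1 2∣c
  by-residue 1 q r<4 _ _ = inj₁ (δ-residue 1 q r<4)
  by-residue 2 q r<4 _ _ = inj₂ (δ-residue 2 q r<4 , subst (4 ∣_) (sym c≡4q) (n∣m*n q))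
    where
    c≡4q : cOf (2 ℕ.+ q ℕ.* 4) ≡ q ℕ.* 4
    c≡4q = trans (cOf-residue 2 q r<4) (trans (cong (_/ 2) (ℕ.*-comm 2 (q ℕ.* 4))) (m*n/n≡m (q ℕ.* 4) 2))
  by-residue 3 q r<4 _ _ = inj₁ (δ-residue 3 q r<4)
  by-residue (suc (suc (suc (suc _)))) q (ℕ.s≤s (ℕ.s≤s (ℕ.s≤s (ℕ.s≤s ())))) 

prime∣m∧gcd[m,n]≡1⇒∤n : ∀ {p m n} → Prime p → p ∣ m → gcd m n ≡ 1 → ¬ (p ∣ n)
prime∣m∧gcd[m,n]≡1⇒∤n p-prime p∣m gcd≡1 p∣n =
  ¬prime[1] (subst Prime (∣1⇒≡1 (subst (_ ∣_) gcd≡1 (gcd-greatest p∣m p∣n))) p-prime)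

gcd₃≡1⇒prime∤one : ∀ {p a₁ a₂ a₃} → Prime p → gcd (gcd a₁ a₂) a₃ ≡ 1 → ¬ (p ∣ a₁) ⊎ ¬ (p ∣ a₂) ⊎ ¬ (p ∣ a₃)
gcd₃≡1⇒prime∤one {p} {a₁} {a₂} {a₃} p-prime gcd≡1 with p ∣? a₁ | p ∣? a₂ | p ∣? a₃
... | no p∤a₁ | _        | _        = inj₁ p∤a₁
... | yes _   | no p∤a₂  | _        = inj₂ (inj₁ p∤a₂)
... | yes _   | yes _    | no p∤a₃  = inj₂ (inj₂ p∤a₃)
... | yes p∣a₁ | yes p∣a₂ | yes p∣a₃ =
  ⊥-elim (prime∣m∧gcd[m,n]≡1⇒∤n p-prime (gcd-greatest p∣a₁ p∣a₂) gcd≡1 p∣a₃)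

∤-*₃ : ∀ {p x y z} → ¬ (p ∣ x ℕ.* y ℕ.* z) → ¬ (p ∣ x) × ¬ (p ∣ y) × ¬ (p ∣ z)
∤-*₃ {p} {x} {y} {z} p∤xyz =
  (λ p∣x → p∤xyz (ℕ.∣m⇒∣m*n z (ℕ.∣m⇒∣m*n y p∣x))) ,
  (λ p∣y → p∤xyz (ℕ.∣m⇒∣m*n z (ℕ.∣n⇒∣m*n x p∣y))) ,
  (λ p∣z → p∤xyz (ℕ.∣n⇒∣m*n (x ℕ.* y) p∣z))

RepZp-gf-β : ∀ {p} c d a₁ a₂ a₃ α₁ α₂ α₃ n → Prime p → p ∣ c → (p ≡ 2 → d ≡ 4 ⊎ (d ≡ 2 × 4 ∣ c)) →
  gcd (gcd a₁ a₂) a₃ ≡ 1 → gcd c (α₁ ℕ.* α₂ ℕ.* α₃) ≡ 1 →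
  RepZp p (gf c a₁ a₂ a₃ α₁ α₂ α₃)
    (+ (d ℕ.* c ℕ.* n ℕ.+ (a₁ ℕ.* (α₁ ℕ.* α₁) ℕ.+ a₂ ℕ.* (α₂ ℕ.* α₂) ℕ.+ a₃ ℕ.* (α₃ ℕ.* α₃))))
RepZp-gf-β {p} c d a₁ a₂ a₃ α₁ α₂ α₃ n p-prime p∣c two-adic gcd-a≡1 gcd-cα≡1 =
  by-coordinate (gcd₃≡1⇒prime∤one {p} {a₁} {a₂} {a₃} p-prime gcd-a≡1)
  where
  D s₁ s₂ s₃ : ℕ
  D = d ℕ.* c ℕ.* n
  s₁ = a₁ ℕ.* (α₁ ℕ.* α₁)
  s₂ = a₂ ℕ.* (α₂ ℕ.* α₂)
  s₃ = a₃ ℕ.* (α₃ ℕ.* α₃)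

  p∤α : ¬ (p ∣ α₁) × ¬ (p ∣ α₂) × ¬ (p ∣ α₃)
  p∤α = ∤-*₃ (prime∣m∧gcd[m,n]≡1⇒∤n p-prime p∣c gcd-cα≡1)

  moved : ∀ {a α} → ¬ (p ∣ a) → ¬ (p ∣ α) → RepZp₁ p (shiftedSquare c a α) (+ (D ℕ.+ a ℕ.* (α ℕ.* α)))
  moved = shiftedSquare-rep n d p-prime p∣c two-adic

  regroup₁ : + (D ℕ.+ (s₁ ℕ.+ s₂ ℕ.+ s₃)) ≡ + (D ℕ.+ s₁) + + s₂ + + s₃
  regroup₁ = trans (cong +_ (shuffle D s₁ s₂ s₃)) (pos-+₃ (D ℕ.+ s₁) s₂ s₃)
    where
    shuffle : ∀ w x y z → w ℕ.+ (x ℕ.+ y ℕ.+ z) ≡ w ℕ.+ x ℕ.+ y ℕ.+ z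
    shuffle = ℕ-solve-∀

  regroup₂ : + (D ℕ.+ (s₁ ℕ.+ s₂ ℕ.+ s₃)) ≡ + s₁ + + (D ℕ.+ s₂) + + s₃
  regroup₂ = trans (cong +_ (shuffle D s₁ s₂ s₃)) (pos-+₃ s₁ (D ℕ.+ s₂) s₃)
    where
    shuffle : ∀ w x y z → w ℕ.+ (x ℕ.+ y ℕ.+ z) ≡ x ℕ.+ (w ℕ.+ y) ℕ.+ z
    shuffle = ℕ-solve-∀

  regroup₃ : + (D ℕ.+ (s₁ ℕ.+ s₂ ℕ.+ s₃)) ≡ + s₁ + + s₂ + + (D ℕ.+ s₃)
  regroup₃ = trans (cong +_ (shuffle D s₁ s₂ s₃)) (pos-+₃ s₁ s₂ (D ℕ.+ s₃))
    where
    shuffle : ∀ w x y z → w ℕ.+ (x ℕ.+ y ℕ.+ z) ≡ x ℕ.+ y ℕ.+ (w ℕ.+ z)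
    shuffle = ℕ-solve-∀

  by-coordinate : ¬ (p ∣ a₁) ⊎ ¬ (p ∣ a₂) ⊎ ¬ (p ∣ a₃) →
    RepZp p (gf c a₁ a₂ a₃ α₁ α₂ α₃) (+ (D ℕ.+ (s₁ ℕ.+ s₂ ℕ.+ s₃)))
  by-coordinate (inj₁ p∤a₁) = subst (RepZp p (gf c a₁ a₂ a₃ α₁ α₂ α₃)) (sym regroup₁)
    (RepZp-sum (moved p∤a₁ (proj₁ p∤α)) (RepZp₁-shiftedSquare-0 p c a₂ α₂) (RepZp₁-shiftedSquare-0 p c a₃ α₃))
  by-coordinate (inj₂ (inj₁ p∤a₂)) = subst (RepZp p (gf c a₁ a₂ a₃ α₁ α₂ α₃)) (sym regroup₂)
    (RepZp-sum (RepZp₁-shiftedSquare-0 p c a₁ α₁) (moved p∤a₂ (proj₁ (proj₂ p∤α))) (RepZp₁-shiftedSquare-0 p c a₃ α₃))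
  by-coordinate (inj₂ (inj₂ p∤a₃)) = subst (RepZp p (gf c a₁ a₂ a₃ α₁ α₂ α₃)) (sym regroup₃)
    (RepZp-sum (RepZp₁-shiftedSquare-0 p c a₁ α₁) (RepZp₁-shiftedSquare-0 p c a₂ α₂) (moved p∤a₃ (proj₂ (proj₂ p∤α))))

RepZp-gf⇒RepZp-Qd : ∀ {p} c a₁ a₂ a₃ α₁ α₂ α₃ {b} →
  RepZp p (gf c a₁ a₂ a₃ α₁ α₂ α₃) b → RepZp p (Qd a₁ a₂ a₃) b
RepZp-gf⇒RepZp-Qd {p} c a₁ a₂ a₃ α₁ α₂ α₃ (u , u-zp , u-rep) = v , v-zp , u-rep
  where
  α : Fin 3 → ℕ
  α = α₁ ∷ α₂ ∷ α₃ ∷ []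

  v : SeqV
  v i k = + c * u i k + + α i

  v-zp : IsZpV p v
  v-zp i = IsZp-+ʳ (+ α i) (λ k → + c * u i k) (IsZp-*ˡ (+ c) (u i) (u-zp i))

affine-surjective : ∀ {p c} α → Prime p → ¬ (p ∣ c) → ∀ v → IsZp p v →
  ∃[ y ] (IsZp p y × EqZp p (λ k → + c * y k + α) v)
affine-surjective {p} {c} α p-prime p∤c v v-zp =
  let y , y-zp , y-root = hensel {p} {0ℤ} {+ c} (divides 0ℤ refl) (prime∤⇒UnitMod p-prime p∤c)
                                 (λ k → v k - α) (IsZp-+ʳ (- α) v v-zp)
  in y , y-zp , λ k →
     ∣⇒Cong {p} {k} {+ c * y k + α} {v k} (subst (+ (p ℕ.^ k) ∣ℤ_) (shift (+ c) (y k) (v k) α)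
       (Cong⇒∣ {p} {k} {quadratic 0ℤ (+ c) (y k)} {v k - α} (y-root k)))
  where
  shift : ∀ c y v α → (0ℤ * (y * y) + c * y) - (v - α) ≡ (c * y + α) - v
  shift = solve-∀

Qd-cong : ∀ {M} a₁ a₂ a₃ (x y : Z3) → (∀ i → M ∣ℤ x i - y i) → M ∣ℤ Qd a₁ a₂ a₃ x - Qd a₁ a₂ a₃ y
Qd-cong {M} a₁ a₂ a₃ x y x≈y = subst (M ∣ℤ_) (sym (difference (+ a₁) (+ a₂) (+ a₃) (x zero) (x (suc zero)) (x (suc (suc zero))) (y zero) (y (suc zero)) (y (suc (suc zero)))))
  (∣m∣n⇒∣m+n (∣m∣n⇒∣m+n (term (+ a₁) zero) (term (+ a₂) (suc zero))) (term (+ a₃) (suc (suc zero))))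
  where
  term : ∀ a i → M ∣ℤ a * (x i - y i) * (x i + y i)
  term a i = ∣m⇒∣m*n (x i + y i) (∣n⇒∣m*n a (x≈y i))
  difference : ∀ a₁ a₂ a₃ x₀ x₁ x₂ y₀ y₁ y₂ →
    (a₁ * (x₀ * x₀) + a₂ * (x₁ * x₁) + a₃ * (x₂ * x₂)) - (a₁ * (y₀ * y₀) + a₂ * (y₁ * y₁) + a₃ * (y₂ * y₂))
    ≡ a₁ * (x₀ - y₀) * (x₀ + y₀) + a₂ * (x₁ - y₁) * (x₁ + y₁) + a₃ * (x₂ - y₂) * (x₂ + y₂)
  difference = solve-∀

RepZp-Qd⇒RepZp-gf : ∀ {p} c a₁ a₂ a₃ α₁ α₂ α₃ {b} → Prime p → ¬ (p ∣ c) →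
  RepZp p (Qd a₁ a₂ a₃) b → RepZp p (gf c a₁ a₂ a₃ α₁ α₂ α₃) b
RepZp-Qd⇒RepZp-gf {p} c a₁ a₂ a₃ α₁ α₂ α₃ {b} p-prime p∤c (v , v-zp , v-rep) = u , u-zp , u-rep
  where
  α : Fin 3 → ℕ
  α = α₁ ∷ α₂ ∷ α₃ ∷ []

  preimage : ∀ i → ∃[ y ] (IsZp p y × EqZp p (λ k → + c * y k + + α i) (v i))
  preimage i = affine-surjective (+ α i) p-prime p∤c (v i) (v-zp i)

  u : SeqV
  u i = proj₁ (preimage i)

  u-zp : IsZpV p u
  u-zp i = proj₁ (proj₂ (preimage i))

  shifted : ℕ → Z3
  shifted k i = + c * u i k + + α i

  u-rep : EqZp p (λ k → gf c a₁ a₂ a₃ α₁ α₂ α₃ (at u k)) (const b)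
  u-rep k = ∣⇒Cong {p} {k} {Qd a₁ a₂ a₃ (shifted k)} {b} (subst (+ (p ℕ.^ k) ∣ℤ_) (telescope (Qd a₁ a₂ a₃ (shifted k)) (Qd a₁ a₂ a₃ (at v k)) b)
    (∣m∣n⇒∣m+n (Qd-cong a₁ a₂ a₃ (shifted k) (at v k) (λ i → Cong⇒∣ {p} {k} {shifted k i} {v i k} (proj₂ (proj₂ (preimage i)) k)))
               (Cong⇒∣ {p} {k} {Qd a₁ a₂ a₃ (at v k)} {b} (v-rep k))))
    where
    telescope : ∀ x y z → (x - y) + (y - z) ≡ x - z
    telescope = solve-∀


lemma3p4 : (m : ℕ) → m ≥ 4 →
  (a₁ a₂ a₃ α₁ α₂ α₃ : ℕ) →
  0 < a₁ → a₁ ℕ.≤ a₂ → a₂ ℕ.≤ a₃ →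
  gcd (gcd a₁ a₂) a₃ ≡ 1 →
  (∀ p → Prime p → ¬ (p ∣ cOf m) → Stable p a₁ a₂ a₃) →
  0 < α₁ → 2 ℕ.* α₁ < cOf m →
  0 < α₂ → 2 ℕ.* α₂ < cOf m →
  0 < α₃ → 2 ℕ.* α₃ < cOf m →
  gcd (cOf m) (α₁ ℕ.* α₂ ℕ.* α₃) ≡ 1 →
  TightRegular (gf (cOf m) a₁ a₂ a₃ α₁ α₂ α₃) →
  IsMin (gf (cOf m) a₁ a₂ a₃ α₁ α₂ α₃)
        (+ (a₁ ℕ.* (α₁ ℕ.* α₁) ℕ.+ a₂ ℕ.* (α₂ ℕ.* α₂) ℕ.+ a₃ ℕ.* (α₃ ℕ.* α₃)))
  × (∀ p → Prime p → p ∣ cOf m → ∀ (n : ℕ) →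
       RepZp p (gf (cOf m) a₁ a₂ a₃ α₁ α₂ α₃)
         (+ (δ m ℕ.* cOf m ℕ.* n ℕ.+ (a₁ ℕ.* (α₁ ℕ.* α₁) ℕ.+ a₂ ℕ.* (α₂ ℕ.* α₂) ℕ.+ a₃ ℕ.* (α₃ ℕ.* α₃)))))
  × (∀ p → Prime p → ¬ (p ∣ cOf m) → ∀ (n : ℕ) →
       RepZp p (gf (cOf m) a₁ a₂ a₃ α₁ α₂ α₃)
         (+ (δ m ℕ.* cOf m ℕ.* n ℕ.+ (a₁ ℕ.* (α₁ ℕ.* α₁) ℕ.+ a₂ ℕ.* (α₂ ℕ.* α₂) ℕ.+ a₃ ℕ.* (α₃ ℕ.* α₃))))
       ⇔ RepZp p (Qd a₁ a₂ a₃)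
         (+ (δ m ℕ.* cOf m ℕ.* n ℕ.+ (a₁ ℕ.* (α₁ ℕ.* α₁) ℕ.+ a₂ ℕ.* (α₂ ℕ.* α₂) ℕ.+ a₃ ℕ.* (α₃ ℕ.* α₃)))))
lemma3p4 m m≥4 a₁ a₂ a₃ α₁ α₂ α₃ _ _ _ gcd-a≡1 _ _ 2α₁<c _ 2α₂<c _ 2α₃<c gcd-cα≡1 _ =
  gf-min c a₁ a₂ a₃ α₁ α₂ α₃ 2α₁<c 2α₂<c 2α₃<c ,
  (λ p p-prime p∣c n → RepZp-gf-β c (δ m) a₁ a₂ a₃ α₁ α₂ α₃ n p-prime p∣c (λ { refl → cOf-even⇒δ m m≥4 p∣c })
                                  gcd-a≡1 gcd-cα≡1) ,
  (λ p p-prime p∤c n → mk⇔ (RepZp-gf⇒RepZp-Qd c a₁ a₂ a₃ α₁ α₂ α₃) (RepZp-Qd⇒RepZp-gf c a₁ a₂ a₃ α₁ α₂ α₃ p-prime p∤c))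
  where
  c : ℕ
  c = cOf m
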